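{- Let $n$ be a positive integer and $x\in\mathbb{C}$ such that $x+n+2$, $x+n+3$, $x+n+4$ are nonzero and $\binom{x+n}{k}\neq0$ for $1\le k\le n$. Define \begin{align*} \alpha_n&=\frac{1}{x+n+2}-\frac{3n+6}{x+n+3}+\frac{n^2+5n+6}{x+n+4},\\ \beta_n&=\frac{2x+2n+3}{(x+n+2)^2}-\frac{7x+15+2n(x+n+5)}{(x+n+3)^2}+\frac{5x+14+n(2x+n+8)}{(x+n+4)^2},\\ \gamma_n&=\left\{\frac{2x+2n+3}{(x+n+2)^2}-\frac{5x+5n+12}{(x+n+3)^2}+\frac{3x+3n+10}{(x+n+4)^2}\right\}(x+n+1). \end{align*} Then \[ \sum_{k=1}^n\frac{(-1)^k}{\binom{x+n}{k}}\,k^2H_{k}=(n+1)\frac{(-1)^n}{\binom{x+n}{n}}\big\{\alpha_nH_{n+1}+\beta_n\big\}+\gamma_n. \]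
   Context: $H_0=0$ and $H_m=\sum_{j=1}^m \frac1j$ for $m\ge1$. For $z\in\mathbb{C}$ and $k\in\mathbb{N}_0$, $\binom{z}{k}=\frac{z(z-1)\cdots(z-k+1)}{k!}$. -}

module Defs where

open import Level using (_⊔_) renaming (suc to lsuc)
open import Data.Nat as ℕ using (ℕ; zero; suc; _!)
open import Relation.Nullary using (¬_)
open import Algebra.Bundles using (CommutativeRing)

ιR : ∀ {c ℓ} (R : CommutativeRing c ℓ) → ℕ → CommutativeRing.Carrier R
ιR R zero    = CommutativeRing.0# R
ιR R (suc m) = CommutativeRing._+_ R (CommutativeRing.1# R) (ιR R m)

-- A field of characteristic zero, presented as a commutative ring with a
-- (total) inverse function that is a genuine inverse on nonzero elements,
-- and in which no positive natural number vanishes.  (The standard library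
-- has no classical Field bundle.)  The value of inv at 0# is irrelevant.
record CharZeroField c ℓ : Set (lsuc (c ⊔ ℓ)) where
  field
    commutativeRing : CommutativeRing c ℓ
  open CommutativeRing commutativeRing public
  field
    inv         : Carrier → Carrier
    inv-inverse : ∀ a → ¬ (a ≈ 0#) → a * inv a ≈ 1#
    charZero    : ∀ m → ¬ (ιR commutativeRing (suc m) ≈ 0#)

  ι : ℕ → Carrier
  ι = ιR commutativeRing

module CZF {c ℓ} (F : CharZeroField c ℓ) where
  open CharZeroField F

  sign : ℕ → Carrier
  sign zero    = 1#
  sign (suc k) = - 1# * sign k

  fall : Carrier → ℕ → Carrier
  fall z zero    = 1#
  fall z (suc k) = fall z k * (z - ι k)

  binom : Carrier → ℕ → Carrier
  binom z k = fall z k * inv (ι (k !))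

  sum1 : ℕ → (ℕ → Carrier) → Carrier
  sum1 zero    f = 0#
  sum1 (suc m) f = sum1 m f + f (suc m)

  H : ℕ → Carrier
  H m = sum1 m (λ j → inv (ι j))

  sq : Carrier → Carrier
  sq a = a * a

  α : ℕ → Carrier → Carrier
  α n x = inv (x + ι n + ι 2)
          - ι (3 ℕ.* n ℕ.+ 6) * inv (x + ι n + ι 3)
          + ι (n ℕ.* n ℕ.+ 5 ℕ.* n ℕ.+ 6) * inv (x + ι n + ι 4)

  β : ℕ → Carrier → Carrier
  β n x = (ι 2 * x + ι (2 ℕ.* n) + ι 3) * inv (sq (x + ι n + ι 2))
          - (ι 7 * x + ι 15 + ι (2 ℕ.* n) * (x + ι n + ι 5)) * inv (sq (x + ι n + ι 3))
          + (ι 5 * x + ι 14 + ι n * (ι 2 * x + ι n + ι 8)) * inv (sq (x + ι n + ι 4))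

  γ : ℕ → Carrier → Carrier
  γ n x = ( (ι 2 * x + ι (2 ℕ.* n) + ι 3) * inv (sq (x + ι n + ι 2))
          - (ι 5 * x + ι (5 ℕ.* n) + ι 12) * inv (sq (x + ι n + ι 3))
          + (ι 3 * x + ι (3 ℕ.* n) + ι 10) * inv (sq (x + ι n + ι 4)) )
          * (x + ι n + ι 1)

  lhs : ℕ → Carrier → Carrier
  lhs n x = sum1 n (λ k → sign k * inv (binom (x + ι n) k) * (ι k * ι k) * H k)

  rhs : ℕ → Carrier → Carrier
  rhs n x = ι (suc n) * (sign n * inv (binom (x + ι n) n))
              * (α n x * H (suc n) + β n x) + γ n x

-- Fix a = x + n and write uᵢ for 1/(a+i). In partial fractions over the poles a+2, a+3, a+4,
-- α_m, β_m and γ_m (at x = a - m) become the polynomials 𝒜(m), ℬ(m), 𝒞 in m and the uᵢ. With a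
-- fixed, the right-hand side R_m, read as a function of m, telescopes: as
-- 1/binom(a,m+1) = (m+1)/((a-m) binom(a,m)) and H_{m+2} = H_{m+1} + 1/(m+2), the difference
-- R_{m+1} - R_m is the (m+1)-st summand as soon as
--   (m+2) 𝒜(m+1) + (a-m) 𝒜(m) = (m+1)²   and   𝒜(m+1) + (m+2) ℬ(m+1) + (a-m) ℬ(m) = 0,
-- and R_0 = 0 because 𝒜(0) + ℬ(0) + 𝒞 = 0.

module Submission where

open import Defs
open import Data.Nat using (ℕ; _≤_)
open import Relation.Nullary using (¬_)

open import Data.Nat as ℕ using (zero; suc; _<_; s≤s; z≤n; _!)
import Data.Nat.Properties as ℕ
open import Data.Integer as ℤ using (ℤ; +_; -[1+_]; _⊖_)
import Data.Integer.Properties as ℤ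
open import Data.Sign as Sign using (Sign)
open import Data.Maybe using (Maybe; just; nothing)
open import Data.Product using (_×_; _,_)
open import Relation.Nullary using (yes; no)
open import Relation.Binary.PropositionalEquality as ≡ using (_≡_)
open import Algebra.Bundles using (CommutativeRing)
open import Algebra.Solver.Ring.AlmostCommutativeRing
  using (_-Raw-AlmostCommutative⟶_; fromCommutativeRing)

module ℤ-CoefficientSolver {c ℓ} (R : CommutativeRing c ℓ) where
  open CommutativeRing R
  open import Relation.Binary.Reasoning.Setoid setoid
  open import Algebra.Properties.Ring ring using (-1*x≈-x; -0#≈0#; -‿involutive)
  open import Algebra.Properties.AbelianGroup +-abelianGroup using (⁻¹-∙-comm)
  open import Algebra.Properties.CommutativeSemigroup *-commutativeSemigroup using (interchange)

  ι : ℕ → Carrier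
  ι = ιR R

  ι-+ : ∀ m n → ι (m ℕ.+ n) ≈ ι m + ι n
  ι-+ zero    n = sym (+-identityˡ _)
  ι-+ (suc m) n = trans (+-congˡ (ι-+ m n)) (sym (+-assoc _ _ _))

  ι-* : ∀ m n → ι (m ℕ.* n) ≈ ι m * ι n
  ι-* zero    n = sym (zeroˡ _)
  ι-* (suc m) n = begin
    ι (n ℕ.+ m ℕ.* n)      ≈⟨ ι-+ n (m ℕ.* n) ⟩
    ι n + ι (m ℕ.* n)      ≈⟨ +-cong (sym (*-identityˡ _)) (ι-* m n) ⟩
    1# * ι n + ι m * ι n   ≈⟨ distribʳ _ _ _ ⟨
    (1# + ι m) * ι n       ∎

  ⟦_⟧ℤ : ℤ → Carrier
  ⟦ + n ⟧ℤ     = ι n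
  ⟦ -[1+ n ] ⟧ℤ = - ι (suc n)

  ⊖-homo : ∀ m n → ⟦ m ⊖ n ⟧ℤ ≈ ι m - ι n
  ⊖-homo m       zero    = sym (trans (+-congˡ -0#≈0#) (+-identityʳ _))
  ⊖-homo zero    (suc n) = sym (+-identityˡ _)
  ⊖-homo (suc m) (suc n) = begin
    ⟦ suc m ⊖ suc n ⟧ℤ            ≡⟨ ≡.cong ⟦_⟧ℤ (ℤ.[1+m]⊖[1+n]≡m⊖n m n) ⟩
    ⟦ m ⊖ n ⟧ℤ                    ≈⟨ ⊖-homo m n ⟩
    ι m - ι n                     ≈⟨ +-congˡ (+-identityˡ _) ⟨
    ι m + (0# - ι n)              ≈⟨ +-congˡ (+-congʳ (-‿inverseʳ 1#)) ⟨
    ι m + ((1# - 1#) - ι n)       ≈⟨ +-congˡ (+-assoc _ _ _) ⟩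
    ι m + (1# + (- 1# - ι n))     ≈⟨ +-assoc _ _ _ ⟨
    (ι m + 1#) + (- 1# - ι n)     ≈⟨ +-cong (+-comm _ _) (⁻¹-∙-comm _ _) ⟩
    (1# + ι m) - (1# + ι n)       ∎

  +-homo : ∀ i j → ⟦ i ℤ.+ j ⟧ℤ ≈ ⟦ i ⟧ℤ + ⟦ j ⟧ℤ
  +-homo -[1+ m ] -[1+ n ] = begin
    - ι (suc (suc (m ℕ.+ n)))     ≡⟨ ≡.cong (λ k → - ι (suc k)) (≡.sym (ℕ.+-suc m n)) ⟩
    - ι (suc m ℕ.+ suc n)         ≈⟨ -‿cong (ι-+ (suc m) (suc n)) ⟩
    - (ι (suc m) + ι (suc n))     ≈⟨ ⁻¹-∙-comm _ _ ⟨
    - ι (suc m) - ι (suc n)       ∎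
  +-homo -[1+ m ] (+ n)    = trans (⊖-homo n (suc m)) (+-comm _ _)
  +-homo (+ m)    -[1+ n ] = ⊖-homo m (suc n)
  +-homo (+ m)    (+ n)    = ι-+ m n

  ⟦_⟧± : Sign → Carrier
  ⟦ Sign.+ ⟧± = 1#
  ⟦ Sign.- ⟧± = - 1#

  ⟦⟧±-homo : ∀ s t → ⟦ s Sign.* t ⟧± ≈ ⟦ s ⟧± * ⟦ t ⟧±
  ⟦⟧±-homo Sign.+ t      = sym (*-identityˡ _)
  ⟦⟧±-homo Sign.- Sign.+ = sym (*-identityʳ _)
  ⟦⟧±-homo Sign.- Sign.- = sym (trans (-1*x≈-x _) (-‿involutive _))

  ◃-homo : ∀ s n → ⟦ s ℤ.◃ n ⟧ℤ ≈ ⟦ s ⟧± * ι n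
  ◃-homo s      zero    = sym (zeroʳ _)
  ◃-homo Sign.+ (suc n) = sym (*-identityˡ _)
  ◃-homo Sign.- (suc n) = sym (-1*x≈-x _)

  sign-abs : ∀ i → ⟦ i ⟧ℤ ≈ ⟦ ℤ.sign i ⟧± * ι ℤ.∣ i ∣
  sign-abs i = trans (reflexive (≡.cong ⟦_⟧ℤ (≡.sym (ℤ.◃-inverse i)))) (◃-homo (ℤ.sign i) ℤ.∣ i ∣)

  *-homo : ∀ i j → ⟦ i ℤ.* j ⟧ℤ ≈ ⟦ i ⟧ℤ * ⟦ j ⟧ℤ
  *-homo i j = begin
    ⟦ ℤ.sign i Sign.* ℤ.sign j ℤ.◃ ℤ.∣ i ∣ ℕ.* ℤ.∣ j ∣ ⟧ℤ      ≈⟨ ◃-homo (ℤ.sign i Sign.* ℤ.sign j) (ℤ.∣ i ∣ ℕ.* ℤ.∣ j ∣) ⟩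
    ⟦ ℤ.sign i Sign.* ℤ.sign j ⟧± * ι (ℤ.∣ i ∣ ℕ.* ℤ.∣ j ∣)   ≈⟨ *-cong (⟦⟧±-homo (ℤ.sign i) (ℤ.sign j)) (ι-* ℤ.∣ i ∣ ℤ.∣ j ∣) ⟩
    (⟦ ℤ.sign i ⟧± * ⟦ ℤ.sign j ⟧±) * (ι ℤ.∣ i ∣ * ι ℤ.∣ j ∣)  ≈⟨ interchange _ _ _ _ ⟩
    (⟦ ℤ.sign i ⟧± * ι ℤ.∣ i ∣) * (⟦ ℤ.sign j ⟧± * ι ℤ.∣ j ∣)  ≈⟨ *-cong (sign-abs i) (sign-abs j) ⟨
    ⟦ i ⟧ℤ * ⟦ j ⟧ℤ                                          ∎

  neg-homo : ∀ i → ⟦ ℤ.- i ⟧ℤ ≈ - ⟦ i ⟧ℤ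
  neg-homo (+ zero)  = sym -0#≈0#
  neg-homo (+ suc n) = refl
  neg-homo -[1+ n ]  = sym (-‿involutive _)

  ℤ⟶R : CommutativeRing.rawRing ℤ.+-*-commutativeRing -Raw-AlmostCommutative⟶ fromCommutativeRing R
  ℤ⟶R = record
    { ⟦_⟧ = ⟦_⟧ℤ ; +-homo = +-homo ; *-homo = *-homo ; -‿homo = neg-homo
    ; 0-homo = refl ; 1-homo = +-identityʳ 1# }

  ≟-coeff : ∀ i j → Maybe (⟦ i ⟧ℤ ≈ ⟦ j ⟧ℤ)
  ≟-coeff i j with i ℤ.≟ j
  ... | yes ≡.refl = just refl
  ... | no _       = nothing

  open import Algebra.Solver.Ring _ _ ℤ⟶R ≟-coeff public

  -- ⟦ con (+ 1) ⟧ is 1# + 0#, not 1#; this expression denotes 1# itself.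
  one : ∀ {k} → Polynomial k
  one = con (+ 0) :^ 0

  κ : ∀ {k} → ℕ → Polynomial k
  κ m = con (+ m)

-- An identity x ≈ y modulo hypotheses lᵢ ≈ rᵢ is proved by letting the ring solver check
-- x = y + Σ qᵢ (lᵢ - rᵢ).
module Certificates {c ℓ} (R : CommutativeRing c ℓ) where
  open CommutativeRing R

  infixr 5 _∷ᶻ_

  _∷ᶻ_ : ∀ {q l r z} → l ≈ r → z ≈ 0# → q * (l - r) + z ≈ 0#
  _∷ᶻ_ {q} {l} {r} {z} l≈r z≈0 = begin
    q * (l - r) + z  ≈⟨ +-cong (*-congˡ (trans (+-congʳ l≈r) (-‿inverseʳ r))) z≈0 ⟩
    q * 0# + 0#      ≈⟨ +-identityʳ _ ⟩
    q * 0#           ≈⟨ zeroʳ q ⟩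
    0#               ∎
    where open import Relation.Binary.Reasoning.Setoid setoid

  ≈-modulo : ∀ {x y z} → x ≈ y + z → z ≈ 0# → x ≈ y
  ≈-modulo x≈y+z z≈0 = trans x≈y+z (trans (+-congˡ z≈0) (+-identityʳ _))

module RingIdentities {c ℓ} (R : CommutativeRing c ℓ) where
  open CommutativeRing R
  open ℤ-CoefficientSolver R
  open Certificates R

  -- pA′ = k² − dA and A′ + pB′ = −dB turn the new terms into k² h − d (A h + B), and dw = 1 cancels d.
  telescoping-step : ∀ {k p d w q s b b′ A A′ B B′ h} →
    d * w ≈ 1# → p * q ≈ 1# → b′ ≈ k * w * b →
    p * A′ + d * A ≈ k * k → A′ + p * B′ + d * B ≈ 0# →
    k * (s * b) * (A * h + B) + - 1# * s * b′ * (k * k) * h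
      ≈ p * (- 1# * s * b′) * (A′ * (h + q) + B′)
  telescoping-step {k} {p} {d} {w} {q} {s} {b} {b′} {A} {A′} {B} {B′} {h} dw≈1 pq≈1 b′≈kwb pA′+dA≈k² A′+pB′+dB≈0 =
    ≈-modulo
      (solve 13 (λ k p d w q s b b′ A A′ B B′ h →
         k :* (s :* b) :* (A :* h :+ B) :+ :- one :* s :* b′ :* (k :* k) :* h
         := p :* (:- one :* s :* b′) :* (A′ :* (h :+ q) :+ B′)
            :+ (s :* b′ :* h :* (p :* A′ :+ d :* A :- k :* k)
            :+ (s :* b′ :* A′ :* (p :* q :- one)
            :+ (s :* b′ :* (A′ :+ p :* B′ :+ d :* B :- κ 0)
            :+ (:- (s :* k :* b :* (A :* h :+ B)) :* (d :* w :- one)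
            :+ (:- (s :* d :* (A :* h :+ B)) :* (b′ :- k :* w :* b)
            :+ κ 0))))))
        refl k p d w q s b b′ A A′ B B′ h)
      (pA′+dA≈k² ∷ᶻ pq≈1 ∷ᶻ A′+pB′+dB≈0 ∷ᶻ dw≈1 ∷ᶻ b′≈kwb ∷ᶻ refl)

  module PartialFractions (a u₂ u₃ u₄ : Carrier)
    (d₂u₂≈1 : (a + ι 2) * u₂ ≈ 1#) (d₃u₃≈1 : (a + ι 3) * u₃ ≈ 1#) (d₄u₄≈1 : (a + ι 4) * u₄ ≈ 1#) where

    𝒜 : Carrier → Carrier
    𝒜 N = u₂ - ι 3 * (N + ι 2) * u₃ + (N + ι 2) * (N + ι 3) * u₄

    ℬ : Carrier → Carrier
    ℬ N = ι 2 * u₂ - u₂ * u₂ - (ι 2 * N + ι 7) * u₃ + ι 3 * (N + ι 2) * (u₃ * u₃)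
          + (ι 2 * N + ι 5) * u₄ - (N + ι 2) * (N + ι 3) * (u₄ * u₄)

    𝒞 : Carrier
    𝒞 = u₂ * u₂ - ι 3 * u₂ + ι 13 * u₃ - ι 6 * (u₃ * u₃) - ι 11 * u₄ + ι 6 * (u₄ * u₄)

    𝒜ₑ : ∀ {k} → Polynomial k → (u₂ u₃ u₄ : Polynomial k) → Polynomial k
    𝒜ₑ N u₂ u₃ u₄ = u₂ :- κ 3 :* (N :+ κ 2) :* u₃ :+ (N :+ κ 2) :* (N :+ κ 3) :* u₄

    ℬₑ : ∀ {k} → Polynomial k → (u₂ u₃ u₄ : Polynomial k) → Polynomial k
    ℬₑ N u₂ u₃ u₄ = κ 2 :* u₂ :- u₂ :* u₂ :- (κ 2 :* N :+ κ 7) :* u₃ :+ κ 3 :* (N :+ κ 2) :* (u₃ :* u₃)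
          :+ (κ 2 :* N :+ κ 5) :* u₄ :- (N :+ κ 2) :* (N :+ κ 3) :* (u₄ :* u₄)

    𝒞ₑ : ∀ {k} → (u₂ u₃ u₄ : Polynomial k) → Polynomial k
    𝒞ₑ u₂ u₃ u₄ = u₂ :* u₂ :- κ 3 :* u₂ :+ κ 13 :* u₃ :- κ 6 :* (u₃ :* u₃) :- κ 11 :* u₄ :+ κ 6 :* (u₄ :* u₄)

    𝒜-recurrence : ∀ N → (1# + (1# + N)) * 𝒜 (1# + N) + (a - N) * 𝒜 N ≈ (1# + N) * (1# + N)
    𝒜-recurrence N = ≈-modulo
      (solve 5 (λ N a u₂ u₃ u₄ →
         (one :+ (one :+ N)) :* 𝒜ₑ (one :+ N) u₂ u₃ u₄ :+ (a :- N) :* 𝒜ₑ N u₂ u₃ u₄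
         := (one :+ N) :* (one :+ N)
            :+ (one :* ((a :+ κ 2) :* u₂ :- one)
            :+ (:- (κ 3 :* (N :+ κ 2)) :* ((a :+ κ 3) :* u₃ :- one)
            :+ ((N :+ κ 2) :* (N :+ κ 3) :* ((a :+ κ 4) :* u₄ :- one)
            :+ κ 0))))
        refl N a u₂ u₃ u₄)
      (d₂u₂≈1 ∷ᶻ d₃u₃≈1 ∷ᶻ d₄u₄≈1 ∷ᶻ refl)

    ℬ-recurrence : ∀ N → 𝒜 (1# + N) + (1# + (1# + N)) * ℬ (1# + N) + (a - N) * ℬ N ≈ 0#
    ℬ-recurrence N = ≈-modulo
      (solve 5 (λ N a u₂ u₃ u₄ →
         𝒜ₑ (one :+ N) u₂ u₃ u₄ :+ (one :+ (one :+ N)) :* ℬₑ (one :+ N) u₂ u₃ u₄ :+ (a :- N) :* ℬₑ N u₂ u₃ u₄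
         := κ 0
            :+ ((κ 2 :- u₂) :* ((a :+ κ 2) :* u₂ :- one)
            :+ ((κ 3 :* (N :+ κ 2) :* u₃ :- (κ 2 :* N :+ κ 7)) :* ((a :+ κ 3) :* u₃ :- one)
            :+ ((κ 2 :* N :+ κ 5 :- (N :+ κ 2) :* (N :+ κ 3) :* u₄) :* ((a :+ κ 4) :* u₄ :- one)
            :+ κ 0))))
        refl N a u₂ u₃ u₄)
      (d₂u₂≈1 ∷ᶻ d₃u₃≈1 ∷ᶻ d₄u₄≈1 ∷ᶻ refl)

    initial-value≈0 : ∀ {b h} → b ≈ 1# → h ≈ 1# → ι 1 * (1# * b) * (𝒜 0# * h + ℬ 0#) + 𝒞 ≈ 0#
    initial-value≈0 {b} {h} b≈1 h≈1 = ≈-modulo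
      (solve 5 (λ b h u₂ u₃ u₄ →
         κ 1 :* (one :* b) :* (𝒜ₑ (κ 0) u₂ u₃ u₄ :* h :+ ℬₑ (κ 0) u₂ u₃ u₄) :+ 𝒞ₑ u₂ u₃ u₄
         := κ 0
            :+ ((𝒜ₑ (κ 0) u₂ u₃ u₄ :* h :+ ℬₑ (κ 0) u₂ u₃ u₄) :* (b :- one)
            :+ (𝒜ₑ (κ 0) u₂ u₃ u₄ :* (h :- one)
            :+ κ 0)))
        refl b h u₂ u₃ u₄)
      (b≈1 ∷ᶻ h≈1 ∷ᶻ refl)

module FieldLemmas {c ℓ} (F : CharZeroField c ℓ) where
  open CharZeroField F
  open CZF F
  open ℤ-CoefficientSolver commutativeRing hiding (ι)
  open Certificates commutativeRing
  open import Relation.Binary.Reasoning.Setoid setoid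

  *≈1⇒≉0 : ∀ {p q} → p * q ≈ 1# → ¬ p ≈ 0#
  *≈1⇒≉0 {p} {q} pq≈1 p≈0 = charZero 0 (begin
    1# + 0#  ≈⟨ +-identityʳ 1# ⟩
    1#       ≈⟨ pq≈1 ⟨
    p * q    ≈⟨ *-congʳ p≈0 ⟩
    0# * q   ≈⟨ zeroˡ q ⟩
    0#       ∎)

  inv-unique : ∀ {p q} → p * q ≈ 1# → q ≈ inv p
  inv-unique {p} {q} pq≈1 = begin
    q                ≈⟨ *-identityʳ q ⟨
    q * 1#           ≈⟨ *-congˡ (inv-inverse p (*≈1⇒≉0 pq≈1)) ⟨
    q * (p * inv p)  ≈⟨ *-assoc q p (inv p) ⟨
    (q * p) * inv p  ≈⟨ *-congʳ (trans (*-comm q p) pq≈1) ⟩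
    1# * inv p       ≈⟨ *-identityˡ _ ⟩
    inv p            ∎

  inv-cong : ∀ {p p′} → ¬ p ≈ 0# → p ≈ p′ → inv p ≈ inv p′
  inv-cong {p} p≉0 p≈p′ = inv-unique (trans (*-congʳ (sym p≈p′)) (inv-inverse p p≉0))

  inv-≈1 : ∀ {p} → p ≈ 1# → inv p ≈ 1#
  inv-≈1 {p} p≈1 = sym (inv-unique (trans (*-identityʳ p) p≈1))

  inv-* : ∀ {p q} → ¬ p ≈ 0# → ¬ q ≈ 0# → inv (p * q) ≈ inv p * inv q
  inv-* {p} {q} p≉0 q≉0 = sym (inv-unique (begin
    (p * q) * (inv p * inv q)  ≈⟨ interchange p q (inv p) (inv q) ⟩
    (p * inv p) * (q * inv q)  ≈⟨ *-cong (inv-inverse p p≉0) (inv-inverse q q≉0) ⟩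
    1# * 1#                    ≈⟨ *-identityˡ 1# ⟩
    1#                         ∎))
    where open import Algebra.Properties.CommutativeSemigroup *-commutativeSemigroup using (interchange)

  inv-sq : ∀ {p} → ¬ p ≈ 0# → inv (sq p) ≈ inv p * inv p
  inv-sq p≉0 = inv-* p≉0 p≉0

  *-≉0ˡ : ∀ {p q} → ¬ p * q ≈ 0# → ¬ p ≈ 0#
  *-≉0ˡ {p} {q} pq≉0 p≈0 = pq≉0 (trans (*-congʳ p≈0) (zeroˡ q))

  *-≉0ʳ : ∀ {p q} → ¬ p * q ≈ 0# → ¬ q ≈ 0#
  *-≉0ʳ {p} {q} pq≉0 q≈0 = pq≉0 (trans (*-congˡ q≈0) (zeroʳ p))

  ι-≉0 : ∀ {m} → 0 < m → ¬ ι m ≈ 0#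
  ι-≉0 {suc m} _ = charZero m

  binom-suc : ∀ z k → binom z (suc k) ≈ binom z k * (z - ι k) * inv (ι (suc k))
  binom-suc z k = begin
    fall z k * (z - ι k) * inv (ι (suc k ℕ.* k !))         ≈⟨ *-congˡ inv-ι-k! ⟩
    fall z k * (z - ι k) * (inv (ι (suc k)) * inv (ι (k !))) ≈⟨ solve 4 (λ f d i j → f :* d :* (i :* j) := f :* j :* d :* i)
                                                                   refl (fall z k) (z - ι k) (inv (ι (suc k))) (inv (ι (k !))) ⟩
    fall z k * inv (ι (k !)) * (z - ι k) * inv (ι (suc k))  ∎
    where
    inv-ι-k! : inv (ι (suc k ℕ.* k !)) ≈ inv (ι (suc k)) * inv (ι (k !))
    inv-ι-k! = trans (inv-cong (ι-≉0 (ℕ.1≤n! (suc k))) (ι-* (suc k) (k !)))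
                     (inv-* (charZero k) (ι-≉0 (ℕ.1≤n! k)))

  binom-suc-≉0 : ∀ z k → ¬ binom z (suc k) ≈ 0# → ¬ binom z k ≈ 0# × ¬ z - ι k ≈ 0#
  binom-suc-≉0 z k nz = let nz′ = *-≉0ˡ (λ e → nz (trans (binom-suc z k) e)) in *-≉0ˡ nz′ , *-≉0ʳ nz′

  inv-binom-suc : ∀ z k → ¬ binom z k ≈ 0# → ¬ z - ι k ≈ 0# →
    inv (binom z (suc k)) ≈ ι (suc k) * inv (z - ι k) * inv (binom z k)
  inv-binom-suc z k bₖ≉0 d≉0 = sym (inv-unique (trans (*-congʳ (binom-suc z k)) (≈-modulo
    (solve 6 (λ B d i K w b →
       B :* d :* i :* (K :* w :* b)
       := one :+ (d :* w :* (K :* i) :* (B :* b :- one) :+ (K :* i :* (d :* w :- one) :+ (one :* (K :* i :- one) :+ κ 0))))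
      refl (binom z k) (z - ι k) (inv (ι (suc k))) (ι (suc k)) (inv (z - ι k)) (inv (binom z k)))
    (inv-inverse _ bₖ≉0 ∷ᶻ inv-inverse _ d≉0 ∷ᶻ inv-inverse _ (charZero k) ∷ᶻ refl))))

  inv-binom-zero : ∀ z → inv (binom z 0) ≈ 1#
  inv-binom-zero z = inv-≈1 (trans (*-identityˡ _) (inv-≈1 (+-identityʳ 1#)))

  H-one : H 1 ≈ 1#
  H-one = trans (+-identityˡ _) (inv-≈1 (+-identityʳ 1#))

module ClosedForm {c ℓ} (F : CharZeroField c ℓ) where
  open CharZeroField F
  open CZF F
  open FieldLemmas F
  open ℤ-CoefficientSolver commutativeRing hiding (ι)
  open Certificates commutativeRing
  open RingIdentities commutativeRing
  open import Relation.Binary.Reasoning.Setoid setoid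
  open import Data.Nat.Tactic.RingSolver using (solve-∀)

  3n+6≡3[n+2] : ∀ n → 3 ℕ.* n ℕ.+ 6 ≡ 3 ℕ.* (n ℕ.+ 2)
  3n+6≡3[n+2] = solve-∀

  n²+5n+6≡[n+2][n+3] : ∀ n → n ℕ.* n ℕ.+ 5 ℕ.* n ℕ.+ 6 ≡ (n ℕ.+ 2) ℕ.* (n ℕ.+ 3)
  n²+5n+6≡[n+2][n+3] = solve-∀

  module AtPoint (x : Carrier) (n : ℕ) (d₂≉0 : ¬ x + ι n + ι 2 ≈ 0#)
    (d₃≉0 : ¬ x + ι n + ι 3 ≈ 0#) (d₄≉0 : ¬ x + ι n + ι 4 ≈ 0#) where

    a u₂ u₃ u₄ : Carrier
    a  = x + ι n
    u₂ = inv (a + ι 2)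
    u₃ = inv (a + ι 3)
    u₄ = inv (a + ι 4)

    open PartialFractions a u₂ u₃ u₄ (inv-inverse _ d₂≉0) (inv-inverse _ d₃≉0) (inv-inverse _ d₄≉0)

    summand : ℕ → Carrier
    summand k = sign k * inv (binom a k) * (ι k * ι k) * H k

    closedForm : ℕ → Carrier
    closedForm m = ι (suc m) * (sign m * inv (binom a m)) * (𝒜 (ι m) * H (suc m) + ℬ (ι m)) + 𝒞

    closedForm-zero : closedForm 0 ≈ 0#
    closedForm-zero = initial-value≈0 (inv-binom-zero a) H-one

    closedForm-suc : ∀ m → ¬ binom a (suc m) ≈ 0# → closedForm m + summand (suc m) ≈ closedForm (suc m)
    closedForm-suc m bₘ₊₁≉0 with binom-suc-≉0 a m bₘ₊₁≉0
    ... | bₘ≉0 , d≉0 = trans (xy∙z≈xz∙y _ 𝒞 _) (+-congʳ (telescoping-step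
      (inv-inverse _ d≉0) (inv-inverse _ (charZero (suc m))) (inv-binom-suc a m bₘ≉0 d≉0)
      (𝒜-recurrence (ι m)) (ℬ-recurrence (ι m))))
      where open import Algebra.Properties.CommutativeSemigroup +-commutativeSemigroup using (xy∙z≈xz∙y)

    sum≈closedForm : ∀ m → (∀ k → 1 ≤ k → k ≤ m → ¬ binom a k ≈ 0#) → sum1 m summand ≈ closedForm m
    sum≈closedForm zero    _      = sym closedForm-zero
    sum≈closedForm (suc m) b≉0 = trans
      (+-congʳ (sum≈closedForm m (λ k 1≤k k≤m → b≉0 k 1≤k (ℕ.m≤n⇒m≤1+n k≤m))))
      (closedForm-suc m (b≉0 (suc m) (s≤s z≤n) ℕ.≤-refl))

    α≈𝒜 : α n x ≈ 𝒜 (ι n)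
    α≈𝒜 = +-cong (+-congˡ (-‿cong (*-congʳ ι[3n+6]))) (*-congʳ ι[n²+5n+6])
      where
      ι[3n+6] : ι (3 ℕ.* n ℕ.+ 6) ≈ ι 3 * (ι n + ι 2)
      ι[3n+6] = begin
        ι (3 ℕ.* n ℕ.+ 6)    ≡⟨ ≡.cong ι (3n+6≡3[n+2] n) ⟩
        ι (3 ℕ.* (n ℕ.+ 2))  ≈⟨ ι-* 3 (n ℕ.+ 2) ⟩
        ι 3 * ι (n ℕ.+ 2)    ≈⟨ *-congˡ (ι-+ n 2) ⟩
        ι 3 * (ι n + ι 2)    ∎
      ι[n²+5n+6] : ι (n ℕ.* n ℕ.+ 5 ℕ.* n ℕ.+ 6) ≈ (ι n + ι 2) * (ι n + ι 3)
      ι[n²+5n+6] = begin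
        ι (n ℕ.* n ℕ.+ 5 ℕ.* n ℕ.+ 6)    ≡⟨ ≡.cong ι (n²+5n+6≡[n+2][n+3] n) ⟩
        ι ((n ℕ.+ 2) ℕ.* (n ℕ.+ 3))      ≈⟨ ι-* (n ℕ.+ 2) (n ℕ.+ 3) ⟩
        ι (n ℕ.+ 2) * ι (n ℕ.+ 3)        ≈⟨ *-cong (ι-+ n 2) (ι-+ n 3) ⟩
        (ι n + ι 2) * (ι n + ι 3)        ∎

    -- In terms of a, the numerators of β are 2(a+2) - 1, (2N+7)(a+3) - 3(N+2), (2N+5)(a+4) - (N+2)(N+3).
    β≈ℬ : β n x ≈ ℬ (ι n)
    β≈ℬ = ≈-modulo
      (solve 9 (λ N x K u₂ u₃ u₄ V₂ V₃ V₄ →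
         let t₂ = κ 2 :* x :+ K :+ κ 3
             t₃ = κ 7 :* x :+ κ 15 :+ K :* (x :+ N :+ κ 5)
             t₄ = κ 5 :* x :+ κ 14 :+ N :* (κ 2 :* x :+ N :+ κ 8)
         in t₂ :* V₂ :- t₃ :* V₃ :+ t₄ :* V₄
            := ℬₑ N u₂ u₃ u₄
               :+ (t₂ :* (V₂ :- u₂ :* u₂)
               :+ (:- t₃ :* (V₃ :- u₃ :* u₃)
               :+ (t₄ :* (V₄ :- u₄ :* u₄)
               :+ ((u₂ :* u₂ :- (x :+ N :+ κ 5) :* (u₃ :* u₃)) :* (K :- κ 2 :* N)
               :+ (κ 2 :* u₂ :* ((x :+ N :+ κ 2) :* u₂ :- one)
               :+ (:- ((κ 2 :* N :+ κ 7) :* u₃) :* ((x :+ N :+ κ 3) :* u₃ :- one)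
               :+ ((κ 2 :* N :+ κ 5) :* u₄ :* ((x :+ N :+ κ 4) :* u₄ :- one)
               :+ κ 0))))))))
        refl (ι n) x (ι (2 ℕ.* n)) u₂ u₃ u₄ (inv (sq (a + ι 2))) (inv (sq (a + ι 3))) (inv (sq (a + ι 4))))
      (inv-sq d₂≉0 ∷ᶻ inv-sq d₃≉0 ∷ᶻ inv-sq d₄≉0 ∷ᶻ ι-* 2 n
        ∷ᶻ inv-inverse _ d₂≉0 ∷ᶻ inv-inverse _ d₃≉0 ∷ᶻ inv-inverse _ d₄≉0 ∷ᶻ refl)

    -- (2a+3)(a+1) = 2(a+2)² - 3(a+2) + 1, (5a+12)(a+1) = 5(a+3)² - 13(a+3) + 6 and
    -- (3a+10)(a+1) = 3(a+4)² - 11(a+4) + 6.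
    γ≈𝒞 : γ n x ≈ 𝒞
    γ≈𝒞 = ≈-modulo
      (solve 11 (λ N x K₂ K₅ K₃ u₂ u₃ u₄ V₂ V₃ V₄ →
         let s₂ = κ 2 :* x :+ K₂ :+ κ 3
             s₃ = κ 5 :* x :+ K₅ :+ κ 12
             s₄ = κ 3 :* x :+ K₃ :+ κ 10
             e  = x :+ N :+ κ 1
             d₂ = x :+ N :+ κ 2
             d₃ = x :+ N :+ κ 3
             d₄ = x :+ N :+ κ 4
         in (s₂ :* V₂ :- s₃ :* V₃ :+ s₄ :* V₄) :* e
            := 𝒞ₑ u₂ u₃ u₄
               :+ (e :* s₂ :* (V₂ :- u₂ :* u₂)
               :+ (:- (e :* s₃) :* (V₃ :- u₃ :* u₃)
               :+ (e :* s₄ :* (V₄ :- u₄ :* u₄)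
               :+ (e :* (u₂ :* u₂) :* (K₂ :- κ 2 :* N)
               :+ (:- (e :* (u₃ :* u₃)) :* (K₅ :- κ 5 :* N)
               :+ (e :* (u₄ :* u₄) :* (K₃ :- κ 3 :* N)
               :+ ((κ 2 :* (d₂ :* u₂ :+ one) :- κ 3 :* u₂) :* (d₂ :* u₂ :- one)
               :+ ((κ 13 :* u₃ :- κ 5 :* (d₃ :* u₃ :+ one)) :* (d₃ :* u₃ :- one)
               :+ ((κ 3 :* (d₄ :* u₄ :+ one) :- κ 11 :* u₄) :* (d₄ :* u₄ :- one)
               :+ κ 0))))))))))
        refl (ι n) x (ι (2 ℕ.* n)) (ι (5 ℕ.* n)) (ι (3 ℕ.* n)) u₂ u₃ u₄
        (inv (sq (a + ι 2))) (inv (sq (a + ι 3))) (inv (sq (a + ι 4))))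
      (inv-sq d₂≉0 ∷ᶻ inv-sq d₃≉0 ∷ᶻ inv-sq d₄≉0 ∷ᶻ ι-* 2 n ∷ᶻ ι-* 5 n ∷ᶻ ι-* 3 n
        ∷ᶻ inv-inverse _ d₂≉0 ∷ᶻ inv-inverse _ d₃≉0 ∷ᶻ inv-inverse _ d₄≉0 ∷ᶻ refl)

corollary9 : ∀ {c ℓ} (F : CharZeroField c ℓ) → let open CharZeroField F in let open CZF F in
    (n : ℕ) → 1 ≤ n → (x : Carrier) →
    ¬ (x + ι n + ι 2 ≈ 0#) → ¬ (x + ι n + ι 3 ≈ 0#) → ¬ (x + ι n + ι 4 ≈ 0#) →
    (∀ k → 1 ≤ k → k ≤ n → ¬ (binom (x + ι n) k ≈ 0#)) →
    lhs n x ≈ rhs n x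
corollary9 F n _ x d₂≉0 d₃≉0 d₄≉0 b≉0 = trans (sum≈closedForm n b≉0)
  (sym (+-cong (*-congˡ (+-cong (*-congʳ α≈𝒜) β≈ℬ)) γ≈𝒞))
  where
  open CharZeroField F
  open ClosedForm.AtPoint F x n d₂≉0 d₃≉0 d₄≉0
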